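{- Let $w$ be a word of length $n\ge 1$ over an alphabet $\Sigma$ with $|Alph(w)|=q$. Then $SP_{n-1}(w)\le 1$ if $n$ is odd and $SP_{n-1}(w)\le 2$ if $n$ is even. Moreover, equality can be achieved only if $2\le q\le\frac{n+2}{2}$ when $n$ is even, and only if $1\le q\le\lceil n/2\rceil$ when $n$ is odd.
   Context: A scattered subword of $w$ is a (not necessarily contiguous) subsequence of $w$. A palindrome is a word equal to its reversal. For $t\ge 0$, $SP_t(w)$ is the number of distinct palindromes of length $t$ that are scattered subwords of $w$. $Alph(w)$ is the set of letters occurring in $w$. -}

module Defs where

open import Level using (Level)
open import Data.Nat using (ℕ; _≟_)
open import Data.List using (List; []; _∷_; _++_; map; filter; length; reverse; deduplicate)
open import Data.List.Properties using (≡-dec)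
open import Data.Product using (_×_)
open import Relation.Nullary using (Dec)
open import Relation.Nullary.Decidable using (_×-dec_)
open import Relation.Binary.Definitions using (DecidableEquality)
open import Relation.Binary.PropositionalEquality using (_≡_)

private variable
  a : Level
  A : Set a

scatteredSubwords : List A → List (List A)
scatteredSubwords [] = [] ∷ []
scatteredSubwords (x ∷ xs) = map (x ∷_) (scatteredSubwords xs) ++ scatteredSubwords xs

IsPalindrome : List A → Set _
IsPalindrome u = reverse u ≡ u

isPalindrome? : DecidableEquality A → (u : List A) → Dec (IsPalindrome u)
isPalindrome? eq u = ≡-dec eq (reverse u) u

SP : DecidableEquality A → ℕ → List A → ℕ
SP eq t w =
  length (deduplicate (≡-dec eq)
    (filter (λ u → (length u ≟ t) ×-dec isPalindrome? eq u) (scatteredSubwords w)))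

alphSize : DecidableEquality A → List A → ℕ
alphSize eq w = length (deduplicate eq w)

{-# OPTIONS --safe #-}
module Submission where

-- Deleting one letter of a word a x b leaves x b, a x, or a y b with y a deletion of x.
-- If a ≢ b only the first two can be palindromes, and both are only if x has even length
-- (a x and x b palindromic make a x b 2-periodic); if a ≡ b the palindromic deletions are
-- a y a for the palindromic deletions y of x.  By induction, two distinct palindromic
-- deletions of w force |w| to be even and leave no room for a third; they also force two
-- distinct letters, since all deletions of a power of one letter coincide.  Finally every
-- letter of a palindrome u occurs in its first ⌈|u|/2⌉ positions, so a word with a
-- palindromic deletion has at most 1 + ⌊|w|/2⌋ distinct letters.

open import Defs
open import Level using (Level)
open import Data.Nat using (ℕ; suc; _+_; _*_; _∸_; _≤_; _≤?_; z≤n; s≤s; _≟_; ⌊_/2⌋; ⌈_/2⌉)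
open import Data.Nat.Properties
  using (+-comm; +-identityʳ; ≤-trans; ≤-reflexive; n≤1+n; ≰⇒>; suc-injective; <-irrefl;
         ⌊n/2⌋-mono; n≡⌈n+n/2⌉)
open import Data.Nat.Divisibility using (_∣_; _∣0; ∣-refl; ∣m∣n⇒∣m+n; ∣m+n∣m⇒∣n; ∣1⇒≡1; m∣m*n)
open import Data.List using (List; []; _∷_; _∷ʳ_; [_]; length; reverse; replicate; map; filter; deduplicate)
open import Data.List.Properties
  using (≡-dec; length-++; length-removeAt′; unfold-reverse; reverse-++; ∷-injective; ∷ʳ-injective)
open import Data.List.Reverse using (reverseView; []; _∶_∶ʳ_)
open import Data.List.Relation.Unary.Any using (here; there; _─_)
open import Data.List.Relation.Unary.All using (All; []; _∷_; all?) renaming (lookup to All-lookup)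
open import Data.List.Relation.Unary.All.Properties using (¬All⇒Any¬)
open import Data.List.Relation.Unary.Unique.Propositional using (Unique; []; _∷_)
open import Data.List.Relation.Unary.Unique.DecPropositional.Properties using (deduplicate-!)
open import Data.List.Membership.Propositional using (_∈_; find)
open import Data.List.Membership.Propositional.Properties
  using (∈-++⁻; ∈-map⁻; ∈-filter⁻; ∈-deduplicate⁻; ∈-deduplicate⁺)
open import Data.List.Relation.Binary.Subset.Propositional using (_⊆_)
open import Data.List.Relation.Binary.Subset.Propositional.Properties using (∷⁺ʳ; ∈-∷⁺ʳ; xs⊆x∷xs; ⊆-trans)
open import Data.Product using (_×_; _,_; proj₁; proj₂; ∃; ∃₂)
open import Data.Sum using (_⊎_; inj₁; inj₂; [_,_]′; swap; map₁)
open import Data.Empty using (⊥-elim)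
open import Function using (_∘_)
open import Relation.Nullary using (¬_; yes; no)
open import Relation.Nullary.Decidable using (_×-dec_)
open import Relation.Binary.Definitions using (DecidableEquality)
open import Relation.Binary.PropositionalEquality using (_≡_; _≢_; ≢-sym; refl; sym; trans; cong; subst)

¬2∣2k+1 : ∀ k → ¬ 2 ∣ 2 * k + 1
¬2∣2k+1 k 2∣2k+1 with () ← ∣1⇒≡1 (∣m+n∣m⇒∣n 2∣2k+1 (m∣m*n k))

⌊n/2⌋≤k : ∀ {n} k → n ≤ suc (2 * k) → ⌊ n /2⌋ ≤ k
⌊n/2⌋≤k k n≤1+2k = ≤-trans (⌊n/2⌋-mono n≤1+2k) (≤-reflexive ⌈2k/2⌉≡k)
  where
  ⌈2k/2⌉≡k : ⌈ 2 * k /2⌉ ≡ k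
  ⌈2k/2⌉≡k = trans (cong (λ m → ⌈ k + m /2⌉) (+-identityʳ k)) (sym (n≡⌈n+n/2⌉ k))

module _ {ℓ : Level} {A : Set ℓ} where

  ∈-─ : ∀ {x y : A} {ys} (x∈ys : x ∈ ys) → y ∈ ys → y ≢ x → y ∈ (ys ─ x∈ys)
  ∈-─ (here refl) (here refl) y≢x = ⊥-elim (y≢x refl)
  ∈-─ (here refl) (there y∈ys) _ = y∈ys
  ∈-─ (there _) (here refl) _ = here refl
  ∈-─ (there x∈ys) (there y∈ys) y≢x = there (∈-─ x∈ys y∈ys y≢x)

  unique-⊆⇒length≤ : {xs ys : List A} → Unique xs → xs ⊆ ys → length xs ≤ length ys
  unique-⊆⇒length≤ [] _ = z≤n
  unique-⊆⇒length≤ {x ∷ xs} {ys} (x∉xs ∷ xs!) x∷xs⊆ys =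
    subst (suc (length xs) ≤_) (sym (length-removeAt′ ys _))
      (s≤s (unique-⊆⇒length≤ xs! λ y∈xs →
        ∈-─ x∈ys (x∷xs⊆ys (there y∈xs)) (≢-sym (All-lookup x∉xs y∈xs))))
    where
    x∈ys : x ∈ ys
    x∈ys = x∷xs⊆ys (here refl)

  unique⇒distinct-pair : ∀ {xs : List A} → Unique xs → 2 ≤ length xs →
    ∃₂ λ u v → u ∈ xs × v ∈ xs × u ≢ v
  unique⇒distinct-pair {u ∷ v ∷ _} ((u≢v ∷ _) ∷ _) (s≤s (s≤s _)) =
    u , v , here refl , there (here refl) , u≢v

  data Bracketed : List A → Set ℓ where
    empty  : Bracketed []
    single : ∀ c → Bracketed [ c ]
    wrap   : ∀ a {x} → Bracketed x → ∀ b → Bracketed (a ∷ (x ∷ʳ b))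

  bracketed-cons : ∀ c {w} → Bracketed w → Bracketed (c ∷ w)
  bracketed-cons c empty = single c
  bracketed-cons c (single d) = wrap c empty d
  bracketed-cons c (wrap a bx b) = wrap c (bracketed-cons a bx) b

  bracketed : ∀ w → Bracketed w
  bracketed [] = empty
  bracketed (c ∷ w) = bracketed-cons c (bracketed w)

  length-wrap : ∀ (a : A) x b → length (a ∷ (x ∷ʳ b)) ≡ 2 + length x
  length-wrap a x b = cong suc (trans (length-++ x) (+-comm (length x) 1))

  2∣length-wrap : ∀ (a : A) x b → 2 ∣ length x → 2 ∣ length (a ∷ (x ∷ʳ b))
  2∣length-wrap a x b 2∣x = subst (2 ∣_) (sym (length-wrap a x b)) (∣m∣n⇒∣m+n ∣-refl 2∣x)

  reverse-wrap : ∀ (a : A) x b → reverse (a ∷ (x ∷ʳ b)) ≡ b ∷ (reverse x ∷ʳ a)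
  reverse-wrap a x b = trans (unfold-reverse a (x ∷ʳ b)) (cong (_∷ʳ a) (reverse-++ x [ b ]))

  palindrome-wrap⁻ : ∀ {a b : A} x → IsPalindrome (a ∷ (x ∷ʳ b)) → a ≡ b × IsPalindrome x
  palindrome-wrap⁻ {a} {b} x pal
    with x-pal , a≡b ← ∷ʳ-injective (reverse x) x (proj₂ (∷-injective (trans (sym (reverse-wrap a x b)) pal)))
    = a≡b , x-pal

  palindrome-letters : ∀ {u} → Bracketed u → IsPalindrome u → ∃ λ h → u ⊆ h × length h ≤ ⌈ length u /2⌉
  palindrome-letters empty _ = [] , (λ ()) , z≤n
  palindrome-letters (single c) _ = [ c ] , (λ c∈ → c∈) , s≤s z≤n
  palindrome-letters (wrap a {x} bx b) pal with refl , x-pal ← palindrome-wrap⁻ x pal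
    with h , x⊆h , |h|≤ ← palindrome-letters bx x-pal
    = a ∷ h , u⊆a∷h , subst (λ n → suc (length h) ≤ ⌈ n /2⌉) (sym (length-wrap a x a)) (s≤s |h|≤)
    where
    u⊆a∷h : a ∷ (x ∷ʳ a) ⊆ a ∷ h
    u⊆a∷h (here refl) = here refl
    u⊆a∷h (there z∈) with ∈-++⁻ x z∈
    ... | inj₁ z∈x = there (x⊆h z∈x)
    ... | inj₂ (here refl) = here refl

  shifted-palindromes⇒2∣length : ∀ {a b : A} {x} → a ≢ b → Bracketed x →
    IsPalindrome (a ∷ x) → IsPalindrome (x ∷ʳ b) → 2 ∣ length x
  shifted-palindromes⇒2∣length _ empty _ _ = 2 ∣0
  shifted-palindromes⇒2∣length a≢b (single c) pal-ac pal-cb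
    with refl , _ ← palindrome-wrap⁻ [] pal-ac
    with refl , _ ← palindrome-wrap⁻ [] pal-cb
    = ⊥-elim (a≢b refl)
  shifted-palindromes⇒2∣length a≢b (wrap c {y} by d) pal-acyd pal-cydb
    with refl , cy-pal ← palindrome-wrap⁻ (c ∷ y) pal-acyd
    with refl , yd-pal ← palindrome-wrap⁻ (y ∷ʳ d) pal-cydb
    = 2∣length-wrap c y d (shifted-palindromes⇒2∣length (≢-sym a≢b) by cy-pal yd-pal)

  data Deletion : List A → List A → Set ℓ where
    delHere  : ∀ {c w} → Deletion (c ∷ w) w
    delThere : ∀ {c w u} → Deletion w u → Deletion (c ∷ w) (c ∷ u)

  deletion-length : ∀ {w u} → Deletion w u → length w ≡ suc (length u)
  deletion-length delHere = refl
  deletion-length (delThere d) = cong suc (deletion-length d)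

  PalindromicDeletion : List A → List A → Set ℓ
  PalindromicDeletion w u = Deletion w u × IsPalindrome u

  deletion-⊆ : ∀ {w u} → Deletion w u → ∃ λ c → w ⊆ c ∷ u
  deletion-⊆ (delHere {c}) = c , λ z∈ → z∈
  deletion-⊆ (delThere {c} {u = u} d) with c′ , w⊆c′∷u ← deletion-⊆ d =
    c′ , ∈-∷⁺ʳ (there (here refl)) (⊆-trans w⊆c′∷u (∷⁺ʳ c′ (xs⊆x∷xs u c)))

  deletion-last : ∀ x (b : A) → Deletion (x ∷ʳ b) x
  deletion-last [] b = delHere
  deletion-last (c ∷ x) b = delThere (deletion-last x b)

  deletion-snoc⁻ : ∀ x (b : A) {u} → Deletion (x ∷ʳ b) u → u ≡ x ⊎ ∃ λ y → Deletion x y × u ≡ y ∷ʳ b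
  deletion-snoc⁻ [] b delHere = inj₁ refl
  deletion-snoc⁻ (c ∷ x) b delHere = inj₂ (x , delHere , refl)
  deletion-snoc⁻ (c ∷ x) b (delThere d) with deletion-snoc⁻ x b d
  ... | inj₁ refl = inj₁ refl
  ... | inj₂ (y , d′ , refl) = inj₂ (c ∷ y , delThere d′ , refl)

  deletion-wrap⁻ : ∀ (a : A) x b {u} → Deletion (a ∷ (x ∷ʳ b)) u →
    u ≡ x ∷ʳ b ⊎ u ≡ a ∷ x ⊎ ∃ λ y → Deletion x y × u ≡ a ∷ (y ∷ʳ b)
  deletion-wrap⁻ a x b delHere = inj₁ refl
  deletion-wrap⁻ a x b (delThere d) with deletion-snoc⁻ x b d
  ... | inj₁ refl = inj₂ (inj₁ refl)
  ... | inj₂ (y , d′ , refl) = inj₂ (inj₂ (y , d′ , refl))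

  palindromicDeletion-≢ : ∀ {a b : A} {x u} → a ≢ b →
    PalindromicDeletion (a ∷ (x ∷ʳ b)) u → u ≡ x ∷ʳ b ⊎ u ≡ a ∷ x
  palindromicDeletion-≢ {a} {b} {x} a≢b (d , pal) with deletion-wrap⁻ a x b d
  ... | inj₁ u≡ = inj₁ u≡
  ... | inj₂ (inj₁ u≡) = inj₂ u≡
  ... | inj₂ (inj₂ (y , _ , refl)) = ⊥-elim (a≢b (proj₁ (palindrome-wrap⁻ y pal)))

  palindromicDeletion-≡ : ∀ {a : A} {x u} → PalindromicDeletion (a ∷ (x ∷ʳ a)) u →
    (x ≡ [] × u ≡ [ a ]) ⊎ ∃ λ y → PalindromicDeletion x y × u ≡ a ∷ (y ∷ʳ a)
  palindromicDeletion-≡ {a} {x} (d , pal) with deletion-wrap⁻ a x a d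
  palindromicDeletion-≡ {x = []} _ | inj₁ refl = inj₁ (refl , refl)
  palindromicDeletion-≡ {x = c ∷ y} (_ , pal) | inj₁ refl
    with refl , y-pal ← palindrome-wrap⁻ y pal
    = inj₂ (y , (delHere , y-pal) , refl)
  palindromicDeletion-≡ {x = x} (_ , pal) | inj₂ (inj₁ refl) with reverseView x
  ... | [] = inj₁ (refl , refl)
  ... | y ∶ _ ∶ʳ c with refl , y-pal ← palindrome-wrap⁻ y pal
    = inj₂ (y , (deletion-last y c , y-pal) , refl)
  palindromicDeletion-≡ (_ , pal) | inj₂ (inj₂ (y , d , refl)) =
    inj₂ (y , (d , proj₂ (palindrome-wrap⁻ y pal)) , refl)

  All-≡⇒replicate : ∀ {c : A} {xs} → All (_≡ c) xs → xs ≡ replicate (length xs) c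
  All-≡⇒replicate [] = refl
  All-≡⇒replicate (refl ∷ all≡) = cong (_ ∷_) (All-≡⇒replicate all≡)

  deletion-replicate : ∀ n {c : A} {u} → Deletion (replicate (suc n) c) u → u ≡ replicate n c
  deletion-replicate n delHere = refl
  deletion-replicate (suc n) (delThere d) = cong (_ ∷_) (deletion-replicate n d)

  ∈-scatteredSubwords⁻ : ∀ (c : A) w {u} → u ∈ scatteredSubwords (c ∷ w) →
    (∃ λ v → v ∈ scatteredSubwords w × u ≡ c ∷ v) ⊎ u ∈ scatteredSubwords w
  ∈-scatteredSubwords⁻ c w = map₁ (∈-map⁻ (c ∷_)) ∘ ∈-++⁻ (map (c ∷_) (scatteredSubwords w))

  scatteredSubword-length≤ : ∀ w {u : List A} → u ∈ scatteredSubwords w → length u ≤ length w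
  scatteredSubword-length≤ [] (here refl) = z≤n
  scatteredSubword-length≤ (c ∷ w) u∈ with ∈-scatteredSubwords⁻ c w u∈
  ... | inj₁ (v , v∈ , refl) = s≤s (scatteredSubword-length≤ w v∈)
  ... | inj₂ u∈w = ≤-trans (scatteredSubword-length≤ w u∈w) (n≤1+n (length w))

  scatteredSubword-length≡ : ∀ w {u : List A} → u ∈ scatteredSubwords w → length u ≡ length w → u ≡ w
  scatteredSubword-length≡ [] (here refl) _ = refl
  scatteredSubword-length≡ (c ∷ w) u∈ |u|≡ with ∈-scatteredSubwords⁻ c w u∈
  ... | inj₁ (v , v∈ , refl) = cong (c ∷_) (scatteredSubword-length≡ w v∈ (suc-injective |u|≡))
  ... | inj₂ u∈w = ⊥-elim (<-irrefl |u|≡ (s≤s (scatteredSubword-length≤ w u∈w)))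

  scatteredSubword⇒deletion : ∀ w {u : List A} → u ∈ scatteredSubwords w →
    suc (length u) ≡ length w → Deletion w u
  scatteredSubword⇒deletion (c ∷ w) u∈ |u|≡ with ∈-scatteredSubwords⁻ c w u∈
  ... | inj₁ (v , v∈ , refl) = delThere (scatteredSubword⇒deletion w v∈ (suc-injective |u|≡))
  ... | inj₂ u∈w with refl ← scatteredSubword-length≡ w u∈w (suc-injective |u|≡) = delHere

module _ {ℓ : Level} {A : Set ℓ} (eq : DecidableEquality A) where

  distinct-palindromicDeletions : ∀ {w u v : List A} → Bracketed w →
    PalindromicDeletion w u → PalindromicDeletion w v → u ≢ v →
    2 ∣ length w × (∀ {r} → PalindromicDeletion w r → r ≡ u ⊎ r ≡ v)
  distinct-palindromicDeletions (single c) (delHere , _) (delHere , _) u≢v = ⊥-elim (u≢v refl)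
  distinct-palindromicDeletions (wrap a {x} bx b) pu pv u≢v with eq a b
  ... | no a≢b with palindromicDeletion-≢ a≢b pu | palindromicDeletion-≢ a≢b pv
  ...   | inj₁ refl | inj₁ refl = ⊥-elim (u≢v refl)
  ...   | inj₂ refl | inj₂ refl = ⊥-elim (u≢v refl)
  ...   | inj₁ refl | inj₂ refl =
    2∣length-wrap a x b (shifted-palindromes⇒2∣length a≢b bx (proj₂ pv) (proj₂ pu)) ,
    palindromicDeletion-≢ a≢b
  ...   | inj₂ refl | inj₁ refl =
    2∣length-wrap a x b (shifted-palindromes⇒2∣length a≢b bx (proj₂ pu) (proj₂ pv)) ,
    swap ∘ palindromicDeletion-≢ a≢b
  distinct-palindromicDeletions (wrap a {x} bx a) pu pv u≢v | yes refl
    with palindromicDeletion-≡ pu | palindromicDeletion-≡ pv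
  ... | inj₁ (_ , refl) | inj₁ (_ , refl) = ⊥-elim (u≢v refl)
  ... | inj₁ (refl , _) | inj₂ (_ , (() , _) , _)
  ... | inj₂ (_ , (() , _) , _) | inj₁ (refl , _)
  ... | inj₂ (y₁ , py₁ , refl) | inj₂ (y₂ , py₂ , refl)
    with 2∣x , only-y₁-y₂ ← distinct-palindromicDeletions bx py₁ py₂ (u≢v ∘ cong (λ y → a ∷ (y ∷ʳ a)))
    = 2∣length-wrap a x a 2∣x , only-u-v
    where
    only-u-v : ∀ {r} → PalindromicDeletion (a ∷ (x ∷ʳ a)) r →
      r ≡ a ∷ (y₁ ∷ʳ a) ⊎ r ≡ a ∷ (y₂ ∷ʳ a)
    only-u-v pr with palindromicDeletion-≡ pr
    ... | inj₁ (refl , _) with () ← proj₁ py₁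
    ... | inj₂ (y , py , refl) with only-y₁-y₂ py
    ...   | inj₁ refl = inj₁ refl
    ...   | inj₂ refl = inj₂ refl

  distinct-deletions⇒distinct-letters : ∀ {w u v : List A} → Deletion w u → Deletion w v → u ≢ v →
    ∃₂ λ c d → c ∈ w × d ∈ w × c ≢ d
  distinct-deletions⇒distinct-letters {c ∷ w} du dv u≢v with all? (λ z → eq z c) w
  ... | yes all≡c = ⊥-elim (u≢v (trans (from-replicate du) (sym (from-replicate dv))))
    where
    from-replicate : ∀ {u} → Deletion (c ∷ w) u → u ≡ replicate (length w) c
    from-replicate d =
      deletion-replicate (length w) (subst (λ w′ → Deletion (c ∷ w′) _) (All-≡⇒replicate all≡c) d)
  ... | no ¬all≡c with d , d∈w , d≢c ← find (¬All⇒Any¬ (λ z → eq z c) w ¬all≡c) =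
    d , c , there d∈w , here refl , d≢c

  distinct-letters⇒2≤alphSize : ∀ {w} {c d : A} → c ∈ w → d ∈ w → c ≢ d → 2 ≤ alphSize eq w
  distinct-letters⇒2≤alphSize c∈w d∈w c≢d = unique-⊆⇒length≤ ((c≢d ∷ []) ∷ [] ∷ []) λ where
    (here refl) → ∈-deduplicate⁺ eq c∈w
    (there (here refl)) → ∈-deduplicate⁺ eq d∈w

  palindromicDeletion⇒alphSize≤ : ∀ {w u} → PalindromicDeletion w u → alphSize eq w ≤ suc ⌊ length w /2⌋
  palindromicDeletion⇒alphSize≤ {w} {u} (d , pal) rewrite deletion-length d
    with c , w⊆c∷u ← deletion-⊆ d
    with h , u⊆h , |h|≤ ← palindrome-letters (bracketed u) pal
    = ≤-trans (unique-⊆⇒length≤ (deduplicate-! eq w) alph⊆c∷h) (s≤s |h|≤)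
    where
    alph⊆c∷h : deduplicate eq w ⊆ c ∷ h
    alph⊆c∷h = ⊆-trans (∈-deduplicate⁻ eq w) (⊆-trans w⊆c∷u (∷⁺ʳ c u⊆h))

  -- SP eq t w is by definition the length of this list.
  palindromicSubwords : ℕ → List A → List (List A)
  palindromicSubwords t w =
    deduplicate (≡-dec eq) (filter (λ u → (length u ≟ t) ×-dec isPalindrome? eq u) (scatteredSubwords w))

  palindromicSubwords-unique : ∀ t w → Unique (palindromicSubwords t w)
  palindromicSubwords-unique t w = deduplicate-! (≡-dec eq) _

  ∈-palindromicSubwords⇒palindromicDeletion : ∀ {c : A} {w u} →
    u ∈ palindromicSubwords (length w) (c ∷ w) → PalindromicDeletion (c ∷ w) u
  ∈-palindromicSubwords⇒palindromicDeletion {c} {w} u∈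
    with u∈ss , |u|≡ , pal ← ∈-filter⁻ (λ u → (length u ≟ length w) ×-dec isPalindrome? eq u)
                                        (∈-deduplicate⁻ (≡-dec eq) _ u∈)
    = scatteredSubword⇒deletion (c ∷ w) u∈ss (cong suc |u|≡) , pal

  module _ {w : List A} {ps : List (List A)} (ps! : Unique ps)
           (ps-pal : ∀ {u} → u ∈ ps → PalindromicDeletion w u) where

    palindromicDeletions-length≤2 : length ps ≤ 2
    palindromicDeletions-length≤2 with length ps ≤? 1
    ... | yes |ps|≤1 = ≤-trans |ps|≤1 (n≤1+n 1)
    ... | no |ps|≰1 with u , v , u∈ , v∈ , u≢v ← unique⇒distinct-pair ps! (≰⇒> |ps|≰1) =
      unique-⊆⇒length≤ {ys = u ∷ v ∷ []} ps! λ r∈ → [ here , there ∘ here ]′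
        (proj₂ (distinct-palindromicDeletions (bracketed w) (ps-pal u∈) (ps-pal v∈) u≢v) (ps-pal r∈))

    palindromicDeletions-length≤1 : ¬ 2 ∣ length w → length ps ≤ 1
    palindromicDeletions-length≤1 odd with length ps ≤? 1
    ... | yes |ps|≤1 = |ps|≤1
    ... | no |ps|≰1 with u , v , u∈ , v∈ , u≢v ← unique⇒distinct-pair ps! (≰⇒> |ps|≰1) =
      ⊥-elim (odd (proj₁ (distinct-palindromicDeletions (bracketed w) (ps-pal u∈) (ps-pal v∈) u≢v)))

    palindromicDeletions-2≤alphSize : 2 ≤ length ps → 2 ≤ alphSize eq w
    palindromicDeletions-2≤alphSize 2≤|ps|
      with u , v , u∈ , v∈ , u≢v ← unique⇒distinct-pair ps! 2≤|ps|
      with c , d , c∈ , d∈ , c≢d ←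
             distinct-deletions⇒distinct-letters (proj₁ (ps-pal u∈)) (proj₁ (ps-pal v∈)) u≢v
      = distinct-letters⇒2≤alphSize c∈ d∈ c≢d

  palindromicDeletions-alphSize≤ : ∀ {w} {ps : List (List A)} → (∀ {u} → u ∈ ps → PalindromicDeletion w u) →
    1 ≤ length ps → alphSize eq w ≤ suc ⌊ length w /2⌋
  palindromicDeletions-alphSize≤ {ps = _ ∷ _} ps-pal _ = palindromicDeletion⇒alphSize≤ (ps-pal (here refl))

proposition4p10 : ∀ {a : Level} {Σ : Set a} (eq : DecidableEquality Σ) (w : List Σ) →
    1 ≤ length w →
    -- n odd, n = 2k+1: SP_{n-1} ≤ 1, and equality forces 1 ≤ q ≤ ⌈n/2⌉ = k+1
    ((k : ℕ) → length w ≡ 2 * k + 1 →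
       SP eq (length w ∸ 1) w ≤ 1
       × (SP eq (length w ∸ 1) w ≡ 1 → 1 ≤ alphSize eq w × alphSize eq w ≤ k + 1))
    ×
    -- n even, n = 2k: SP_{n-1} ≤ 2, and equality forces 2 ≤ q ≤ (n+2)/2 = k+1
    ((k : ℕ) → length w ≡ 2 * k →
       SP eq (length w ∸ 1) w ≤ 2
       × (SP eq (length w ∸ 1) w ≡ 2 → 2 ≤ alphSize eq w × alphSize eq w ≤ k + 1))
proposition4p10 eq (c ∷ w) _ = odd , even
  where
  ps : List (List _)
  ps = palindromicSubwords eq (length w) (c ∷ w)

  ps! : Unique ps
  ps! = palindromicSubwords-unique eq (length w) (c ∷ w)

  ps-pal : ∀ {u} → u ∈ ps → PalindromicDeletion (c ∷ w) u
  ps-pal = ∈-palindromicSubwords⇒palindromicDeletion eq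

  alphSize≤k+1 : ∀ k → suc (length w) ≤ suc (2 * k) → 1 ≤ length ps → alphSize eq (c ∷ w) ≤ k + 1
  alphSize≤k+1 k n≤1+2k 1≤|ps| = subst (alphSize eq (c ∷ w) ≤_) (+-comm 1 k)
    (≤-trans (palindromicDeletions-alphSize≤ eq ps-pal 1≤|ps|) (s≤s (⌊n/2⌋≤k k n≤1+2k)))

  odd : (k : ℕ) → suc (length w) ≡ 2 * k + 1 →
    length ps ≤ 1 × (length ps ≡ 1 → 1 ≤ alphSize eq (c ∷ w) × alphSize eq (c ∷ w) ≤ k + 1)
  odd k n≡2k+1 = palindromicDeletions-length≤1 eq ps! ps-pal (¬2∣2k+1 k ∘ subst (2 ∣_) n≡2k+1)
    , λ |ps|≡1 → s≤s z≤n
               , alphSize≤k+1 k (≤-reflexive (trans n≡2k+1 (+-comm (2 * k) 1))) (≤-reflexive (sym |ps|≡1))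

  even : (k : ℕ) → suc (length w) ≡ 2 * k →
    length ps ≤ 2 × (length ps ≡ 2 → 2 ≤ alphSize eq (c ∷ w) × alphSize eq (c ∷ w) ≤ k + 1)
  even k n≡2k = palindromicDeletions-length≤2 eq ps! ps-pal
    , λ |ps|≡2 → palindromicDeletions-2≤alphSize eq ps! ps-pal (≤-reflexive (sym |ps|≡2))
               , alphSize≤k+1 k (≤-trans (≤-reflexive n≡2k) (n≤1+n _))
                                (≤-trans (s≤s z≤n) (≤-reflexive (sym |ps|≡2)))
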